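{- The following injective morphisms on $\{\mathtt{a},\mathtt{b}\}^*$ are strongly interference-free: (1) $\mathtt{a}\mapsto\mathtt{aab}$, $\mathtt{b}\mapsto\mathtt{bba}$; (2) $\mathtt{a}\mapsto\mathtt{abb}$, $\mathtt{b}\mapsto\mathtt{baa}$; (3) $\mathtt{a}\mapsto\mathtt{aba}$, $\mathtt{b}\mapsto\mathtt{abb}$.
   Context: Images of $\phi$ are $\phi(c)$, $c\in\Sigma$. A word admits an image factorization if it is a concatenation of zero or more images. A word $w$ admits an interfered image factorization if $w=xyz$ with $x$ a proper (possibly empty) suffix of some image, $y$ admitting an image factorization, $z$ a proper (possibly empty) prefix of some image, and $xz\neq\varepsilon$. A word is an inner image factor if it is a proper factor of some image $\phi(c)$ that is neither a prefix nor a suffix of $\phi(c)$. An injective $\phi$ is strongly interference-free if for every non-empty $u\in\Sigma^*$, $\phi(u)$ admits no interfered image factorization and is not an inner image factor. -}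

module Defs where

open import Data.List using (List; []; _∷_; _++_; concatMap)
open import Data.Product using (Σ; ∃; _×_; _,_)
open import Relation.Binary.PropositionalEquality using (_≡_)
open import Relation.Nullary using (¬_)

Morphism : Set → Set
Morphism A = A → List A

ext : {A : Set} → Morphism A → List A → List A
ext φ u = concatMap φ u

InjectiveMorphism : {A : Set} → Morphism A → Set
InjectiveMorphism {A} φ = (u v : List A) → ext φ u ≡ ext φ v → u ≡ v

NonEmpty : {A : Set} → List A → Set
NonEmpty xs = ¬ (xs ≡ [])

ImageFactorization : {A : Set} → Morphism A → List A → Set
ImageFactorization {A} φ w = Σ (List A) λ u → w ≡ ext φ u

ProperSuffixOfImage : {A : Set} → Morphism A → List A → Set
ProperSuffixOfImage {A} φ x =
  Σ A λ c → Σ (List A) λ p → NonEmpty p × (p ++ x ≡ φ c)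

ProperPrefixOfImage : {A : Set} → Morphism A → List A → Set
ProperPrefixOfImage {A} φ z =
  Σ A λ c → Σ (List A) λ s → NonEmpty s × (z ++ s ≡ φ c)

InterferedImageFactorization : {A : Set} → Morphism A → List A → Set
InterferedImageFactorization {A} φ w =
  Σ (List A) λ x → Σ (List A) λ y → Σ (List A) λ z →
    (w ≡ x ++ y ++ z) × ProperSuffixOfImage φ x × ImageFactorization φ y
    × ProperPrefixOfImage φ z × NonEmpty (x ++ z)

InnerImageFactorOf : {A : Set} → Morphism A → A → List A → Set
InnerImageFactorOf {A} φ c w =
  (Σ (List A) λ p → Σ (List A) λ s → p ++ w ++ s ≡ φ c)
  × ¬ (w ≡ φ c)
  × ¬ (Σ (List A) λ t → w ++ t ≡ φ c)
  × ¬ (Σ (List A) λ t → t ++ w ≡ φ c)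

InnerImageFactor : {A : Set} → Morphism A → List A → Set
InnerImageFactor {A} φ w = Σ A λ c → InnerImageFactorOf φ c w

StronglyInterferenceFree : {A : Set} → Morphism A → Set
StronglyInterferenceFree {A} φ =
  InjectiveMorphism φ ×
  ((u : List A) → NonEmpty u →
     ¬ InterferedImageFactorization φ (ext φ u) × ¬ InnerImageFactor φ (ext φ u))

data AB : Set where
  a b : AB

φ₁ : Morphism AB
φ₁ a = a ∷ a ∷ b ∷ []
φ₁ b = b ∷ b ∷ a ∷ []

φ₂ : Morphism AB
φ₂ a = a ∷ b ∷ b ∷ []
φ₂ b = b ∷ a ∷ a ∷ []

φ₃ : Morphism AB
φ₃ a = a ∷ b ∷ a ∷ []
φ₃ b = a ∷ b ∷ b ∷ []

-- Each φᵢ is 3-uniform with φ(a) ≠ φ(b), and the argument works for any k-uniform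
-- morphism.  Cancelling images of equal length gives injectivity, and φ(u) with u ≠ ε
-- is too long to be an inner image factor.  In an interfered factorization
-- x φ(v) z = φ(c u), an empty x leaves φ(c u) = φ(v) z with 0 < |z| < k, which
-- cancelling images reduces to the absurd case v = ε; a nonempty x splits φ(c) = x w
-- with x a proper suffix and w a proper prefix of images.  Then φ(c) occurs in some
-- φ(c′) φ(e) at a position 0 < i < k, which a finite check excludes for each φᵢ.
module Submission where

open import Defs
open import Data.Empty using (⊥-elim)
open import Data.List using (List; []; _∷_; _++_; length; take; drop)
open import Data.List.Properties
  using (∷-injective; ++-assoc; ++-identityʳ; ++-conicalˡ; ++-conicalʳ; length-++; length-++-≤ˡ; length-++-≤ʳ)
open import Data.Nat using (ℕ; suc; _+_; _≤_; _<_; z≤n; s≤s)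
open import Data.Nat.Properties
  using (suc-injective; ≤-trans; ≤-reflexive; <⇒≤; <⇒≱; <-irrefl; +-comm; +-cancelˡ-≡; m<m+n; m<n+m)
open import Data.Product using (Σ; _×_; _,_; proj₂)
open import Function.Definitions using (Injective)
open import Relation.Binary.PropositionalEquality
  using (_≡_; _≢_; refl; sym; trans; cong; cong₂; subst; module ≡-Reasoning)
open import Relation.Nullary using (¬_)

private variable
  A : Set
  m p q r s t w x z : List A

length-nonEmpty : NonEmpty x → 0 < length x
length-nonEmpty {x = []}    x≢[] = ⊥-elim (x≢[] refl)
length-nonEmpty {x = _ ∷ _} _    = s≤s z≤n

remainder-nonEmpty : length r < length p → p ≡ r ++ m → NonEmpty m
remainder-nonEmpty {r = r} r<p p≡r++m refl =
  <-irrefl (cong length (sym (trans p≡r++m (++-identityʳ r)))) r<p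

drop-length-++ : ∀ (p : List A) → drop (length p) (p ++ x) ≡ x
drop-length-++ []      = refl
drop-length-++ (_ ∷ p) = drop-length-++ p

take-length-++ : ∀ (w : List A) → take (length w) (w ++ s) ≡ w
take-length-++ []      = refl
take-length-++ (y ∷ w) = cong (y ∷_) (take-length-++ w)

++-cancel-length : ∀ (r p : List A) → length p ≡ length r → p ++ q ≡ r ++ t → p ≡ r × q ≡ t
++-cancel-length []      []      _     eq = refl , eq
++-cancel-length (_ ∷ r) (_ ∷ p) |p|≡|r| eq with ∷-injective eq
... | refl , eq′ with ++-cancel-length r p (suc-injective |p|≡|r|) eq′
...   | refl , q≡t = refl , q≡t

++-split : ∀ (r p : List A) → length r ≤ length p → p ++ q ≡ r ++ t →
           Σ (List A) λ m → p ≡ r ++ m × m ++ q ≡ t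
++-split []      p       _         eq = p , refl , eq
++-split (y ∷ r) (_ ∷ p) (s≤s r≤p) eq with ∷-injective eq
... | refl , eq′ with ++-split r p r≤p eq′
...   | m , p≡r++m , m++q≡t = m , cong (y ∷_) p≡r++m , m++q≡t

long-infix⇒prefix : ∀ (p : List A) {w s t} → length t ≤ length w → p ++ w ++ s ≡ t → w ++ s ≡ t
long-infix⇒prefix []      _ eq   = eq
long-infix⇒prefix (_ ∷ p) {w} {s} t≤w refl =
  ⊥-elim (<⇒≱ t≤w (≤-trans (length-++-≤ˡ w) (length-++-≤ʳ (w ++ s) {p})))

Uniform : ℕ → Morphism A → Set
Uniform {A} k φ = (c : A) → length (φ c) ≡ k

SuffixPrefixFree : Morphism A → Set
SuffixPrefixFree {A} φ =
  ∀ {c : A} {x w} → ProperSuffixOfImage φ x → ProperPrefixOfImage φ w → φ c ≢ x ++ w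

-- drop i (φ c′) ++ take i (φ e) is the factor of length k of φ(c′) φ(e) at position i.
NoShiftedImage : ℕ → Morphism A → Set
NoShiftedImage {A} k φ = ∀ {i} → 0 < i → i < k → (c c′ e : A) → φ c ≢ drop i (φ c′) ++ take i (φ e)

module _ {A : Set} {φ : Morphism A} {k : ℕ} (uniform : Uniform k φ) where

  split-length : ∀ x {c} → x ++ w ≡ φ c → length x + length w ≡ k
  split-length x {c} eq = trans (sym (length-++ x)) (trans (cong length eq) (uniform c))

  properSuffix-shorter : ProperSuffixOfImage φ x → length x < k
  properSuffix-shorter (_ , p , p≢[] , p++x≡φc) =
    subst (_ <_) (split-length p p++x≡φc) (m<n+m _ (length-nonEmpty p≢[]))

  properPrefix-shorter : ProperPrefixOfImage φ z → length z < k
  properPrefix-shorter {z = z} (_ , _ , s≢[] , z++s≡φe) =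
    subst (_ <_) (split-length z z++s≡φe) (m<m+n _ (length-nonEmpty s≢[]))

  images-same-length : ∀ c d → length (φ c) ≡ length (φ d)
  images-same-length c d = trans (uniform c) (sym (uniform d))

  ext-long : ∀ c u → k ≤ length (ext φ (c ∷ u))
  ext-long c u = subst (_≤ _) (uniform c) (length-++-≤ˡ (φ c))

  image-nonEmpty : 0 < k → ∀ c → NonEmpty (φ c)
  image-nonEmpty 0<k c φc≡[] = <-irrefl (trans (sym (cong length φc≡[])) (uniform c)) 0<k

  ext-injective : 0 < k → Injective _≡_ _≡_ φ → InjectiveMorphism φ
  ext-injective _   _     []      []      _  = refl
  ext-injective 0<k _     []      (d ∷ v) eq = ⊥-elim (image-nonEmpty 0<k d (++-conicalˡ (φ d) _ (sym eq)))
  ext-injective 0<k _     (c ∷ u) []      eq = ⊥-elim (image-nonEmpty 0<k c (++-conicalˡ (φ c) _ eq))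
  ext-injective 0<k φ-inj (c ∷ u) (d ∷ v) eq
    with ++-cancel-length (φ d) (φ c) (images-same-length c d) eq
  ... | φc≡φd , eq′ = cong₂ _∷_ (φ-inj φc≡φd) (ext-injective 0<k φ-inj u v eq′)

  ext-notInner : ∀ u → NonEmpty u → ¬ InnerImageFactor φ (ext φ u)
  ext-notInner []      u≢[] _ = u≢[] refl
  ext-notInner (c ∷ u) _    (d , (p , s , p++w++s≡φd) , _ , notPrefix , _) =
    notPrefix (s , long-infix⇒prefix p {ext φ (c ∷ u)} φd≤w p++w++s≡φd)
    where
    φd≤w : length (φ d) ≤ length (ext φ (c ∷ u))
    φd≤w = ≤-trans (≤-reflexive (uniform d)) (ext-long c u)

  ext-≢-ext-++ : ∀ u v → NonEmpty z → length z < k → ext φ u ≢ ext φ v ++ z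
  ext-≢-ext-++         []      v       z≢[] _   eq = z≢[] (++-conicalʳ (ext φ v) _ (sym eq))
  ext-≢-ext-++         (c ∷ u) []      _    z<k eq = <⇒≱ z<k (subst (λ t → k ≤ length t) eq (ext-long c u))
  ext-≢-ext-++ {z = z} (c ∷ u) (d ∷ v) z≢[] z<k eq =
    ext-≢-ext-++ u v z≢[] z<k
      (proj₂ (++-cancel-length (φ d) (φ c) (images-same-length c d)
                               (trans eq (++-assoc (φ d) (ext φ v) z))))

  remainder-isProperPrefix : ∀ u v → length m < k → ProperPrefixOfImage φ z →
                             m ++ ext φ u ≡ ext φ v ++ z → ProperPrefixOfImage φ m
  remainder-isProperPrefix {m = m} {z = z} u [] _ (e , s , s≢[] , z++s≡φe) m++u≡z =
    e , ext φ u ++ s , (λ us≡[] → s≢[] (++-conicalʳ (ext φ u) s us≡[])) , (begin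
      m ++ ext φ u ++ s   ≡⟨ ++-assoc m (ext φ u) s ⟨
      (m ++ ext φ u) ++ s ≡⟨ cong (_++ s) m++u≡z ⟩
      z ++ s              ≡⟨ z++s≡φe ⟩
      φ e                 ∎)
    where open ≡-Reasoning
  remainder-isProperPrefix {m = m} {z = z} u (d ∷ v) m<k _ m++u≡v++z =
    let s , φd≡m++s , _ = ++-split m (φ d) (<⇒≤ m<φd) (sym (trans m++u≡v++z (++-assoc (φ d) (ext φ v) z)))
    in  d , s , remainder-nonEmpty m<φd φd≡m++s , sym φd≡m++s
    where
    m<φd : length m < length (φ d)
    m<φd = subst (length m <_) (sym (uniform d)) m<k

  ext-notInterfered : SuffixPrefixFree φ → ∀ u → NonEmpty u → ¬ InterferedImageFactorization φ (ext φ u)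
  ext-notInterfered _   []      u≢[] _ = u≢[] refl
  ext-notInterfered _   (c ∷ u) _    ([] , _ , z , eq , _ , (v , refl) , z-pre , z≢[]) =
    ext-≢-ext-++ (c ∷ u) v z≢[] (properPrefix-shorter z-pre) eq
  ext-notInterfered spf (c ∷ u) _    (x@(_ ∷ _) , _ , z , eq , x-suf , (v , refl) , z-pre , _) =
    let m , φc≡x++m , m++u≡v++z = ++-split x (φ c) x≤φc eq
        m<k = subst (length m <_) (split-length x (sym φc≡x++m)) (m<n+m _ (s≤s z≤n))
    in  spf x-suf (remainder-isProperPrefix u v m<k z-pre m++u≡v++z) φc≡x++m
    where
    x≤φc : length x ≤ length (φ c)
    x≤φc = ≤-trans (<⇒≤ (properSuffix-shorter x-suf)) (≤-reflexive (sym (uniform c)))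

  noShiftedImage⇒suffixPrefixFree : NoShiftedImage k φ → SuffixPrefixFree φ
  noShiftedImage⇒suffixPrefixFree noShifted {c} {x} {w}
    (c′ , p , p≢[] , p++x≡φc′) w-pre@(e , s , _ , w++s≡φe) φc≡x++w =
    noShifted (length-nonEmpty p≢[]) p<k c c′ e (begin
      φ c                                             ≡⟨ φc≡x++w ⟩
      x ++ w                                          ≡⟨ cong₂ _++_ x≡drop w≡take ⟩
      drop (length p) (φ c′) ++ take (length p) (φ e) ∎)
    where
    open ≡-Reasoning
    |w|≡|p| : length w ≡ length p
    |w|≡|p| = +-cancelˡ-≡ (length x) _ _ (begin
      length x + length w ≡⟨ split-length x (sym φc≡x++w) ⟩
      k                   ≡⟨ split-length p p++x≡φc′ ⟨
      length p + length x ≡⟨ +-comm (length p) (length x) ⟩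
      length x + length p ∎)
    p<k : length p < k
    p<k = subst (_< k) |w|≡|p| (properPrefix-shorter w-pre)
    x≡drop : x ≡ drop (length p) (φ c′)
    x≡drop = trans (sym (drop-length-++ p)) (cong (drop (length p)) p++x≡φc′)
    w≡take : w ≡ take (length p) (φ e)
    w≡take = trans (sym (take-length-++ w)) (cong₂ take |w|≡|p| w++s≡φe)

  uniform⇒stronglyInterferenceFree : 0 < k → Injective _≡_ _≡_ φ → SuffixPrefixFree φ →
                                     StronglyInterferenceFree φ
  uniform⇒stronglyInterferenceFree 0<k φ-inj spf =
    ext-injective 0<k φ-inj , λ u u≢[] → ext-notInterfered spf u u≢[] , ext-notInner u u≢[]

AB-injective : (φ : Morphism AB) → φ a ≢ φ b → Injective _≡_ _≡_ φ
AB-injective _ _     {a} {a} _  = refl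
AB-injective _ φa≢φb {a} {b} eq = ⊥-elim (φa≢φb eq)
AB-injective _ φa≢φb {b} {a} eq = ⊥-elim (φa≢φb (sym eq))
AB-injective _ _     {b} {b} _  = refl

binary-3-uniform⇒stronglyInterferenceFree : (φ : Morphism AB) → Uniform 3 φ → φ a ≢ φ b →
                                            NoShiftedImage 3 φ → StronglyInterferenceFree φ
binary-3-uniform⇒stronglyInterferenceFree φ uniform φa≢φb noShifted =
  uniform⇒stronglyInterferenceFree uniform (s≤s z≤n) (AB-injective φ φa≢φb)
    (noShiftedImage⇒suffixPrefixFree uniform noShifted)

φ₁-noShiftedImage : NoShiftedImage 3 φ₁
φ₁-noShiftedImage {0} ()
φ₁-noShiftedImage {1} _ _ a a a ()
φ₁-noShiftedImage {1} _ _ a a b ()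
φ₁-noShiftedImage {1} _ _ a b a ()
φ₁-noShiftedImage {1} _ _ a b b ()
φ₁-noShiftedImage {1} _ _ b a a ()
φ₁-noShiftedImage {1} _ _ b a b ()
φ₁-noShiftedImage {1} _ _ b b a ()
φ₁-noShiftedImage {1} _ _ b b b ()
φ₁-noShiftedImage {2} _ _ a a a ()
φ₁-noShiftedImage {2} _ _ a a b ()
φ₁-noShiftedImage {2} _ _ a b a ()
φ₁-noShiftedImage {2} _ _ a b b ()
φ₁-noShiftedImage {2} _ _ b a a ()
φ₁-noShiftedImage {2} _ _ b a b ()
φ₁-noShiftedImage {2} _ _ b b a ()
φ₁-noShiftedImage {2} _ _ b b b ()
φ₁-noShiftedImage {suc (suc (suc _))} _ (s≤s (s≤s (s≤s ())))

φ₂-noShiftedImage : NoShiftedImage 3 φ₂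
φ₂-noShiftedImage {0} ()
φ₂-noShiftedImage {1} _ _ a a a ()
φ₂-noShiftedImage {1} _ _ a a b ()
φ₂-noShiftedImage {1} _ _ a b a ()
φ₂-noShiftedImage {1} _ _ a b b ()
φ₂-noShiftedImage {1} _ _ b a a ()
φ₂-noShiftedImage {1} _ _ b a b ()
φ₂-noShiftedImage {1} _ _ b b a ()
φ₂-noShiftedImage {1} _ _ b b b ()
φ₂-noShiftedImage {2} _ _ a a a ()
φ₂-noShiftedImage {2} _ _ a a b ()
φ₂-noShiftedImage {2} _ _ a b a ()
φ₂-noShiftedImage {2} _ _ a b b ()
φ₂-noShiftedImage {2} _ _ b a a ()
φ₂-noShiftedImage {2} _ _ b a b ()
φ₂-noShiftedImage {2} _ _ b b a ()
φ₂-noShiftedImage {2} _ _ b b b ()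
φ₂-noShiftedImage {suc (suc (suc _))} _ (s≤s (s≤s (s≤s ())))

φ₃-noShiftedImage : NoShiftedImage 3 φ₃
φ₃-noShiftedImage {0} ()
φ₃-noShiftedImage {1} _ _ a a a ()
φ₃-noShiftedImage {1} _ _ a a b ()
φ₃-noShiftedImage {1} _ _ a b a ()
φ₃-noShiftedImage {1} _ _ a b b ()
φ₃-noShiftedImage {1} _ _ b a a ()
φ₃-noShiftedImage {1} _ _ b a b ()
φ₃-noShiftedImage {1} _ _ b b a ()
φ₃-noShiftedImage {1} _ _ b b b ()
φ₃-noShiftedImage {2} _ _ a a a ()
φ₃-noShiftedImage {2} _ _ a a b ()
φ₃-noShiftedImage {2} _ _ a b a ()
φ₃-noShiftedImage {2} _ _ a b b ()
φ₃-noShiftedImage {2} _ _ b a a ()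
φ₃-noShiftedImage {2} _ _ b a b ()
φ₃-noShiftedImage {2} _ _ b b a ()
φ₃-noShiftedImage {2} _ _ b b b ()
φ₃-noShiftedImage {suc (suc (suc _))} _ (s≤s (s≤s (s≤s ())))

corollary16 : StronglyInterferenceFree φ₁ × StronglyInterferenceFree φ₂ × StronglyInterferenceFree φ₃
corollary16 = binary-3-uniform⇒stronglyInterferenceFree φ₁ (λ { a → refl ; b → refl }) (λ ()) φ₁-noShiftedImage
            , binary-3-uniform⇒stronglyInterferenceFree φ₂ (λ { a → refl ; b → refl }) (λ ()) φ₂-noShiftedImage
            , binary-3-uniform⇒stronglyInterferenceFree φ₃ (λ { a → refl ; b → refl }) (λ ()) φ₃-noShiftedImage
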